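{- If a multiplier $-\ltimes U:\mathcal W\to\mathcal V$ is cancellative, then it is strongly cancellative, i.e. for every $W_0\in\mathcal W$ the functor $\mathrm{Fr}^{W_0}_U:\mathcal W/W_0\to\mathcal V/(W_0\ltimes U)$ is faithful.
   Context: $\mathcal W$ has a terminal object $\top$. A multiplier for $U\in\mathcal V$ is a functor $-\ltimes U:\mathcal W\to\mathcal V$ with an isomorphism $\top\ltimes U\cong U$; $\pi_2:W\ltimes U\to U$ is $(!_W\ltimes U)$ followed by it. $\mathrm{Fr}_U:\mathcal W\to\mathcal V/U$, $W\mapsto(W\ltimes U,\pi_2)$, $f\mapsto f\ltimes U$; the multiplier is cancellative if $\mathrm{Fr}_U$ is faithful. $\mathrm{Fr}^{W_0}_U(W,\psi)=(W\ltimes U,\psi\ltimes U)$ and $\mathrm{Fr}^{W_0}_U(f)=f\ltimes U$. -}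

module Defs where

open import Level using (Level; _⊔_) renaming (suc to lsuc)
open import Relation.Binary.Core using (Rel)
open import Relation.Binary.Structures using (IsEquivalence)

record Category (o ℓ e : Level) : Set (lsuc (o ⊔ ℓ ⊔ e)) where
  infix  4 _≈_
  infixr 9 _∘_
  field
    Obj : Set o
    _⇒_ : Obj → Obj → Set ℓ
    _≈_ : ∀ {A B} → Rel (A ⇒ B) e
    id  : ∀ {A} → A ⇒ A
    _∘_ : ∀ {A B C} → B ⇒ C → A ⇒ B → A ⇒ C
    equiv     : ∀ {A B} → IsEquivalence (_≈_ {A} {B})
    assoc     : ∀ {A B C D} {f : A ⇒ B} {g : B ⇒ C} {h : C ⇒ D} →
                (h ∘ g) ∘ f ≈ h ∘ (g ∘ f)
    identityˡ : ∀ {A B} {f : A ⇒ B} → id ∘ f ≈ f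
    identityʳ : ∀ {A B} {f : A ⇒ B} → f ∘ id ≈ f
    ∘-resp-≈  : ∀ {A B C} {f h : B ⇒ C} {g i : A ⇒ B} →
                f ≈ h → g ≈ i → f ∘ g ≈ h ∘ i

  module Eq {A B} = IsEquivalence (equiv {A} {B})

record Functor {o ℓ e o′ ℓ′ e′ : Level} (C : Category o ℓ e) (D : Category o′ ℓ′ e′)
       : Set (o ⊔ ℓ ⊔ e ⊔ o′ ⊔ ℓ′ ⊔ e′) where
  private
    module C = Category C
    module D = Category D
  field
    F₀ : C.Obj → D.Obj
    F₁ : ∀ {A B} → A C.⇒ B → F₀ A D.⇒ F₀ B
    identity     : ∀ {A} → F₁ (C.id {A}) D.≈ D.id
    homomorphism : ∀ {X Y Z} {f : X C.⇒ Y} {g : Y C.⇒ Z} →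
                   F₁ (g C.∘ f) D.≈ F₁ g D.∘ F₁ f
    F-resp-≈     : ∀ {A B} {f g : A C.⇒ B} → f C.≈ g → F₁ f D.≈ F₁ g

Faithful : ∀ {o ℓ e o′ ℓ′ e′} {C : Category o ℓ e} {D : Category o′ ℓ′ e′} →
           Functor C D → Set (o ⊔ ℓ ⊔ e ⊔ e′)
Faithful {C = C} {D = D} F =
  ∀ {A B} (f g : A C.⇒ B) → F₁ f D.≈ F₁ g → f C.≈ g
  where
    module C = Category C
    module D = Category D
    open Functor F

record Terminal {o ℓ e} (C : Category o ℓ e) : Set (o ⊔ ℓ ⊔ e) where
  open Category C
  field
    ⊤        : Obj
    !        : ∀ {A} → A ⇒ ⊤
    !-unique : ∀ {A} (f : A ⇒ ⊤) → ! ≈ f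

record Iso {o ℓ e} (C : Category o ℓ e) (A B : Category.Obj C) : Set (ℓ ⊔ e) where
  open Category C
  field
    from : A ⇒ B
    to   : B ⇒ A
    isoˡ : to ∘ from ≈ id
    isoʳ : from ∘ to ≈ id

module _ {o ℓ e} (C : Category o ℓ e) where
  open Category C

  record SliceObj (A : Obj) : Set (o ⊔ ℓ) where
    constructor sliceobj
    field
      {Y} : Obj
      arr : Y ⇒ A

  record Slice⇒ {A : Obj} (X X′ : SliceObj A) : Set (ℓ ⊔ e) where
    constructor slicearr
    private
      module X  = SliceObj X
      module X′ = SliceObj X′
    field
      {h} : X.Y ⇒ X′.Y
      △   : X′.arr ∘ h ≈ X.arr

  Slice : Obj → Category (o ⊔ ℓ) (ℓ ⊔ e) e
  Slice A = record
    { Obj = SliceObj A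
    ; _⇒_ = Slice⇒
    ; _≈_ = λ f g → Slice⇒.h f ≈ Slice⇒.h g
    ; id  = λ {X} → slicearr {h = id} identityʳ
    ; _∘_ = λ {X} {X′} {X″} g f →
              slicearr {h = Slice⇒.h g ∘ Slice⇒.h f}
                (Eq.trans (Eq.sym assoc)
                  (Eq.trans (∘-resp-≈ (Slice⇒.△ g) Eq.refl) (Slice⇒.△ f)))
    ; equiv = record { refl = Eq.refl ; sym = Eq.sym ; trans = Eq.trans }
    ; assoc = assoc
    ; identityˡ = identityˡ
    ; identityʳ = identityʳ
    ; ∘-resp-≈ = ∘-resp-≈
    }

record Multiplier {o ℓ e o′ ℓ′ e′} {W : Category o ℓ e} {V : Category o′ ℓ′ e′}
       (T : Terminal W) (U : Category.Obj V) : Set (o ⊔ ℓ ⊔ e ⊔ o′ ⊔ ℓ′ ⊔ e′) where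
  field
    ⋉U  : Functor W V
    unit : Iso V (Functor.F₀ ⋉U (Terminal.⊤ T)) U

module _ {o ℓ e o′ ℓ′ e′} {W : Category o ℓ e} {V : Category o′ ℓ′ e′}
         {T : Terminal W} {U : Category.Obj V} (M : Multiplier {V = V} T U) where
  private
    module W = Category W
    module V = Category V
    open Terminal T
    open Multiplier M
    open Functor ⋉U

  π₂ : (X : W.Obj) → F₀ X V.⇒ U
  π₂ X = Iso.from unit V.∘ F₁ (! {X})

  Fr : Functor W (Slice V U)
  Fr = record
    { F₀ = λ X → sliceobj (π₂ X)
    ; F₁ = λ {X} {X′} f → slicearr {h = F₁ f}
             (V.Eq.trans V.assoc (V.∘-resp-≈ V.Eq.refl
               (V.Eq.trans (V.Eq.sym homomorphism)
                 (F-resp-≈ (W.Eq.sym (!-unique (! W.∘ f)))))))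
    ; identity = identity
    ; homomorphism = homomorphism
    ; F-resp-≈ = F-resp-≈
    }

  Fr^ : (W₀ : W.Obj) → Functor (Slice W W₀) (Slice V (F₀ W₀))
  Fr^ W₀ = record
    { F₀ = λ X → sliceobj (F₁ (SliceObj.arr X))
    ; F₁ = λ f → slicearr {h = F₁ (Slice⇒.h f)}
             (V.Eq.trans (V.Eq.sym homomorphism) (F-resp-≈ (Slice⇒.△ f)))
    ; identity = identity
    ; homomorphism = homomorphism
    ; F-resp-≈ = F-resp-≈
    }

  Cancellative : Set (o ⊔ ℓ ⊔ e ⊔ e′)
  Cancellative = Faithful Fr

  StronglyCancellative : Set (o ⊔ ℓ ⊔ e ⊔ e′)
  StronglyCancellative = ∀ (W₀ : W.Obj) → Faithful (Fr^ W₀)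

module Submission where

open import Defs
open import Level using (Level)

-- Both Fr and Fr^{W₀} send a morphism to f ⋉ U, and morphisms of slices are compared
-- by their underlying arrows, so faithfulness of Fr is literally faithfulness of Fr^{W₀}.
mainTheorem9 : ∀ {o ℓ e o′ ℓ′ e′ : Level} {W : Category o ℓ e} {V : Category o′ ℓ′ e′}
    (T : Terminal W) (U : Category.Obj V) (M : Multiplier {V = V} T U) →
    Cancellative M → StronglyCancellative M
mainTheorem9 T U M cancellative W₀ f g Fr^f≈Fr^g =
  cancellative (Slice⇒.h f) (Slice⇒.h g) Fr^f≈Fr^g
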